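{- Let $\Delta$ be a simplicial complex of dimension $d\ge1$ and let $\Sigma\Delta$ be its suspension. Then $\Phi_\Delta(q)=\Phi_{\Sigma\Delta}(q)$ for every positive integer $q$.
   Context: All simplicial complexes are finite. The suspension $\Sigma\Delta$ of $\Delta$ (with vertex set $V$) is the $(d+1)$-dimensional simplicial complex $\Delta\cup\{\sigma\cup\{t\}:\sigma\in\Delta\}\cup\{\sigma\cup\{b\}:\sigma\in\Delta\}$, where $t,b\notin V$ are two new vertices and $\Delta$ is regarded as containing the empty simplex (so $\{t\},\{b\}$ are vertices). For a simplicial complex $K$ of dimension $m$ with set $F$ of $m$-simplices and $R$ of $(m-1)$-simplices, fix orientations and let $\partial\in\mathbb{Z}^{R\times F}$ be the boundary matrix; a $q$-flow is $\varphi\in\{0,\dots,q-1\}^F$ with $\partial\varphi\equiv0\pmod q$, nowhere-zero if all entries are nonzero, and $\Phi_K(q)$ is the number of nowhere-zero $q$-flows. -}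

module Defs where

open import Data.Nat using (ℕ; zero; suc; _≤_; _+_)
open import Data.Bool using (Bool; true; false; _∧_; not; if_then_else_; T)
import Data.Bool as B
open import Data.Fin using (Fin)
open import Data.Fin.Subset using (Subset; _⊆_; ∣_∣; inside; outside)
open import Data.Vec using (Vec; []; _∷_)
open import Data.Vec.Properties using (≡-dec)
open import Data.List using (List; []; _∷_; map; concatMap; filter; length; upTo; zip; foldr)
open import Data.Integer as ℤ using (ℤ; +_)
open import Data.Nat.Divisibility using (_∣?_)
open import Data.Product using (Σ; _×_; _,_)
open import Relation.Nullary using (does)
open import Relation.Binary.PropositionalEquality using (_≡_)

-- A "complex" on the ground set Fin n is given by its face-membership predicate
-- on subsets of Fin n (vertex set V ⊆ Fin n).
FacePred : ℕ → Set
FacePred n = Subset n → Bool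

IsComplex : ∀ {n} → FacePred n → Set
IsComplex {n} K = (σ τ : Subset n) → τ ⊆ σ → T (K σ) → T (K τ)

HasDim : ∀ {n} → FacePred n → ℕ → Set
HasDim {n} K d =
  Σ (Subset n) (λ σ → T (K σ) × ∣ σ ∣ ≡ suc d)
  × ((σ : Subset n) → T (K σ) → ∣ σ ∣ ≤ suc d)

-- Suspension: vertex set Fin (2 + n); ground element 0 is t, 1 is b,
-- old vertex i becomes i + 2.  Faces: σ, σ ∪ {t}, σ ∪ {b} for σ ∈ Δ.
suspension : ∀ {n} → FacePred n → FacePred (suc (suc n))
suspension K (t ∷ b ∷ σ) = not (t ∧ b) ∧ K σ

allSubsets : (n : ℕ) → List (Subset n)
allSubsets zero = [] ∷ []
allSubsets (suc n) = concatMap (λ s → (outside ∷ s) ∷ (inside ∷ s) ∷ []) (allSubsets n)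

-- The list of faces of K with exactly k vertices ((k-1)-simplices).
facesOfSize : ∀ {n} → FacePred n → ℕ → List (Subset n)
facesOfSize {n} K k = filter (λ σ → T? (K σ B.∧ (∣ σ ∣ Data.Nat.≡ᵇ k))) (allSubsets n)
  where
  T? : (b : Bool) → Relation.Nullary.Dec (T b)
  T? = B.T?

-- Boundary matrix entry [ρ : σ] with the orientation of each simplex given by
-- the increasing order of its vertices: if ρ = σ minus its i-th vertex
-- (0-indexed), the entry is (-1)^i; otherwise 0.
incidence : ∀ {n} → Subset n → Subset n → ℤ
incidence [] [] = + 0
incidence (true ∷ ρ) (true ∷ σ) = ℤ.- incidence ρ σ
incidence (false ∷ ρ) (false ∷ σ) = incidence ρ σ
incidence (false ∷ ρ) (true ∷ σ) = if does (≡-dec B._≟_ ρ σ) then + 1 else + 0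
incidence (true ∷ ρ) (false ∷ σ) = + 0

allB : {A : Set} → (A → Bool) → List A → Bool
allB p [] = true
allB p (x ∷ xs) = p x ∧ allB p xs

-- All functions F → {0,…,q-1}, as lists of length k (k = |F|).
allAssignments : ℕ → ℕ → List (List ℕ)
allAssignments q zero = [] ∷ []
allAssignments q (suc k) = concatMap (λ v → map (v ∷_) (allAssignments q k)) (upTo q)

boundaryAt : ∀ {n} → List (Subset n) → List ℕ → Subset n → ℤ
boundaryAt F φ ρ = foldr (λ p acc → incidence ρ (Data.Product.proj₁ p) ℤ.* (+ Data.Product.proj₂ p) ℤ.+ acc) (+ 0) (zip F φ)

isNZFlow : ∀ {n} → FacePred n → ℕ → ℕ → List ℕ → Bool
isNZFlow K m q φ =
  allB (λ v → not (v Data.Nat.≡ᵇ 0)) φ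
  ∧ allB (λ ρ → does (q ∣? ℤ.∣ boundaryAt (facesOfSize K (suc m)) φ ρ ∣)) (facesOfSize K m)

Φ : ∀ {n} → FacePred n → (m q : ℕ) → ℕ
Φ K m q = length (filter (λ φ → B.T? (isNZFlow K m q φ)) (allAssignments q (length (facesOfSize K (suc m)))))

-- The facets of ΣΔ are the cones σ ∪ {t} and σ ∪ {b} over the facets σ of Δ (no face of Δ is as large),
-- so a chain on ΣΔ is a pair (a, c) of chains on the facets of Δ. Its boundary is −∂a(τ) at τ ∪ {t},
-- −∂c(τ) at τ ∪ {b}, and a(σ) + c(σ) at a facet σ of Δ. Hence (a, c) is a nowhere-zero q-flow of ΣΔ
-- exactly when a is a nowhere-zero q-flow of Δ and c ≡ −a (mod q), and c is then determined by a.

module Submission where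

open import Defs
open import Data.Nat using (ℕ; zero; suc; pred; _≤_; _<_; _+_; _*_; _∸_; z≤n; s≤s; _≡ᵇ_)
open import Data.Nat.Properties
  using ( +-identityʳ; +-assoc; m+n∸m≡n; m+[n∸m]≡n; m∸n≤m; <⇒≤; <⇒≱; <⇒≢; m<n⇒0<n∸m; m≤m+n
        ; +-mono-<; +-monoʳ-≤; ≡ᵇ⇒≡)
open import Data.Nat.ListAction using (sum)
open import Data.Nat.Divisibility using (_∣_; _∣?_; divides; _∣0; ∣-reflexive; >⇒∤; ∣m∣n⇒∣m+n)
open import Data.Bool using (Bool; true; false; _∧_; not; T; if_then_else_)
import Data.Bool as Bool
open import Data.Bool.Properties using (T-∧; ∧-assoc; ∧-idem; ∧-zeroʳ; ∧-identityʳ)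
open import Data.Fin.Subset using (Subset; ∣_∣; inside; outside)
open import Data.Vec using ([]; _∷_; tail)
open import Data.Vec.Properties using (≡-dec)
open import Data.List using (List; []; _∷_; map; concatMap; filter; length; upTo; applyUpTo; _++_)
open import Data.List.Properties using (map-upTo)
open import Data.List.Membership.Propositional using (_∈_)
open import Data.List.Membership.Propositional.Properties using (∈-filter⁺; ∈-filter⁻)
open import Data.List.Relation.Unary.Any using (here; there)
open import Data.List.Relation.Unary.All using (All; []; _∷_; lookup)
open import Data.List.Relation.Unary.Unique.Propositional using (Unique; []; _∷_)
import Data.List.Relation.Unary.Unique.Propositional.Properties as Unique
open import Data.Integer as ℤ using (ℤ; +_; +0; -_)
open import Data.Integer.Properties using (*-identityˡ; ∣-i∣≡∣i∣)
import Data.Integer.Divisibility.Signed as ℤ∣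
open import Data.Integer.Tactic.RingSolver using (solve-∀)
open import Data.Product using (Σ; _×_; _,_; proj₁; proj₂)
open import Data.Empty using (⊥-elim)
open import Function using (_∘_; _⇔_; mk⇔; Equivalence)
open import Relation.Nullary using (Dec; yes; no; does)
open import Relation.Nullary.Decidable using (T?; dec-true; dec-false)
open import Relation.Binary.PropositionalEquality

T-does : ∀ {A : Set} (a? : Dec A) → T (does a?) ⇔ A
T-does (yes a) = mk⇔ (λ _ → a) (λ _ → _)
T-does (no ¬a) = mk⇔ (λ ()) ¬a

T-injective : ∀ {b c} → T b ⇔ T c → b ≡ c
T-injective {false} {false} _ = refl
T-injective {false} {true} b⇔c = ⊥-elim (Equivalence.from b⇔c _)
T-injective {true} {false} b⇔c = ⊥-elim (Equivalence.to b⇔c _)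
T-injective {true} {true} _ = refl

T-allB : ∀ {A : Set} (p : A → Bool) xs → T (allB p xs) ⇔ (∀ {x} → x ∈ xs → T (p x))
T-allB p [] = mk⇔ (λ _ ()) (λ _ → _)
T-allB p (x ∷ xs) = mk⇔
  (λ h → let (px , pxs) = Equivalence.to T-∧ h in
    λ { (here refl) → px ; (there x∈xs) → Equivalence.to (T-allB p xs) pxs x∈xs })
  (λ h → Equivalence.from T-∧
    (h (here refl) , Equivalence.from (T-allB p xs) (λ x∈xs → h (there x∈xs))))

∧-congˡ-under : ∀ {b b′} c p → (T p → b ≡ b′) → b ∧ (c ∧ p) ≡ (b′ ∧ c) ∧ p
∧-congˡ-under {b} {b′} c false _ =
  trans (cong (b ∧_) (∧-zeroʳ c)) (trans (∧-zeroʳ b) (sym (∧-zeroʳ (b′ ∧ c))))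
∧-congˡ-under {b} c true b≡b′ rewrite b≡b′ _ | ∧-identityʳ c = sym (∧-identityʳ _)

count : {A : Set} → (A → Bool) → List A → ℕ
count p xs = length (filter (T? ∘ p) xs)

count-++ : ∀ {A : Set} (p : A → Bool) xs ys → count p (xs ++ ys) ≡ count p xs + count p ys
count-++ p [] ys = refl
count-++ p (x ∷ xs) ys with p x
... | true = cong suc (count-++ p xs ys)
... | false = count-++ p xs ys

count-map : ∀ {A B : Set} (p : B → Bool) (f : A → B) xs → count p (map f xs) ≡ count (p ∘ f) xs
count-map p f [] = refl
count-map p f (x ∷ xs) with p (f x)
... | true = cong suc (count-map p f xs)
... | false = count-map p f xs

count-concatMap : ∀ {A B : Set} (p : B → Bool) (f : A → List B) xs
  → count p (concatMap f xs) ≡ sum (map (count p ∘ f) xs)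
count-concatMap p f [] = refl
count-concatMap p f (x ∷ xs) =
  trans (count-++ p (f x) (concatMap f xs)) (cong (_+_ (count p (f x))) (count-concatMap p f xs))

count-false : ∀ {A : Set} (xs : List A) → count (λ _ → false) xs ≡ 0
count-false [] = refl
count-false (x ∷ xs) = count-false xs

sum-applyUpTo-cong : ∀ n {f g : ℕ → ℕ} → (∀ i → i < n → f i ≡ g i)
  → sum (applyUpTo f n) ≡ sum (applyUpTo g n)
sum-applyUpTo-cong zero _ = refl
sum-applyUpTo-cong (suc n) f≗g =
  cong₂ _+_ (f≗g 0 (s≤s z≤n)) (sum-applyUpTo-cong n (λ i i<n → f≗g (suc i) (s≤s i<n)))

sum-applyUpTo-zero : ∀ n {f : ℕ → ℕ} → (∀ i → i < n → f i ≡ 0) → sum (applyUpTo f n) ≡ 0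
sum-applyUpTo-zero zero _ = refl
sum-applyUpTo-zero (suc n) f≡0 =
  cong₂ _+_ (f≡0 0 (s≤s z≤n)) (sum-applyUpTo-zero n (λ i i<n → f≡0 (suc i) (s≤s i<n)))

sum-applyUpTo-single : ∀ n m {f : ℕ → ℕ} → m < n → (∀ i → i < n → i ≢ m → f i ≡ 0)
  → sum (applyUpTo f n) ≡ f m
sum-applyUpTo-single (suc n) zero {f} _ f≡0 = trans
  (cong (_+_ (f 0)) (sum-applyUpTo-zero n (λ i i<n → f≡0 (suc i) (s≤s i<n) λ ())))
  (+-identityʳ (f 0))
sum-applyUpTo-single (suc n) (suc m) (s≤s m<n) f≡0 = cong₂ _+_ (f≡0 0 (s≤s z≤n) λ ())
  (sum-applyUpTo-single n m m<n (λ i i<n i≢m → f≡0 (suc i) (s≤s i<n) (i≢m ∘ cong pred)))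

countAssignments : ℕ → ℕ → (List ℕ → Bool) → ℕ
countAssignments q k p = count p (allAssignments q k)

countAssignments-suc : ∀ q k p
  → countAssignments q (suc k) p ≡ sum (applyUpTo (λ v → countAssignments q k (p ∘ (v ∷_))) q)
countAssignments-suc q k p = begin
  count p (concatMap (λ v → map (v ∷_) (allAssignments q k)) (upTo q))
    ≡⟨ count-concatMap p _ (upTo q) ⟩
  sum (map (λ v → count p (map (v ∷_) (allAssignments q k))) (upTo q))
    ≡⟨ cong sum (map-upTo _ q) ⟩
  sum (applyUpTo (λ v → count p (map (v ∷_) (allAssignments q k))) q)
    ≡⟨ sum-applyUpTo-cong q (λ v _ → count-map p (v ∷_) (allAssignments q k)) ⟩
  sum (applyUpTo (λ v → countAssignments q k (p ∘ (v ∷_))) q) ∎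
  where open ≡-Reasoning

countAssignments-cong : ∀ q k {p p′ : List ℕ → Bool}
  → (∀ x → All (_< q) x → length x ≡ k → p x ≡ p′ x)
  → countAssignments q k p ≡ countAssignments q k p′
countAssignments-cong q zero {p} {p′} p≗p′ with p [] | p′ [] | p≗p′ [] [] refl
... | false | false | _ = refl
... | true  | true  | _ = refl
countAssignments-cong q (suc k) {p} {p′} p≗p′ = begin
  countAssignments q (suc k) p
    ≡⟨ countAssignments-suc q k p ⟩
  sum (applyUpTo (λ v → countAssignments q k (p ∘ (v ∷_))) q)
    ≡⟨ sum-applyUpTo-cong q (λ v v<q → countAssignments-cong q k
         λ x x<q ∣x∣≡k → p≗p′ (v ∷ x) (v<q ∷ x<q) (cong suc ∣x∣≡k)) ⟩
  sum (applyUpTo (λ v → countAssignments q k (p′ ∘ (v ∷_))) q)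
    ≡⟨ countAssignments-suc q k p′ ⟨
  countAssignments q (suc k) p′ ∎
  where open ≡-Reasoning

negMod : ℕ → ℕ → ℕ
negMod q zero = zero
negMod q (suc v) = q ∸ suc v

negMod< : ∀ {q v} → v < q → negMod q v < q
negMod< {v = zero} v<q = v<q
negMod< {suc q} {suc v} _ = s≤s (m∸n≤m q v)

∣+negMod : ∀ {q v} → v < q → q ∣ v + negMod q v
∣+negMod {q} {zero} _ = q ∣0
∣+negMod {v = suc v} v<q = ∣-reflexive (sym (m+[n∸m]≡n (<⇒≤ v<q)))

∣+⇒≡negMod : ∀ {q v w} → v < q → w < q → q ∣ v + w → w ≡ negMod q v
∣+⇒≡negMod {v = zero} {zero} _ _ _ = refl
∣+⇒≡negMod {v = zero} {suc w} _ w<q q∣w = ⊥-elim (>⇒∤ w<q q∣w)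
∣+⇒≡negMod {v = suc v} _ _ (divides zero ())
∣+⇒≡negMod {q} {suc v} {w} _ _ (divides 1 eq) =
  trans (sym (m+n∸m≡n (suc v) w)) (cong (_∸ suc v) (trans eq (+-identityʳ q)))
∣+⇒≡negMod {q} {suc v} {w} v<q w<q (divides (suc (suc k)) eq) =
  ⊥-elim (<⇒≱ (+-mono-< v<q w<q) (subst (q + q ≤_) (sym eq) (+-monoʳ-≤ q (m≤m+n q (k * q)))))

negMod≡ᵇ0 : ∀ {q v} → v < q → (negMod q v ≡ᵇ 0) ≡ (v ≡ᵇ 0)
negMod≡ᵇ0 {v = zero} _ = refl
negMod≡ᵇ0 {q} {suc v} v<q with q ∸ suc v | m<n⇒0<n∸m v<q
... | suc _ | _ = refl

evens odds : {A : Set} → List A → List A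
evens [] = []
evens (x ∷ xs) = x ∷ odds xs
odds [] = []
odds (x ∷ xs) = evens xs

double : ℕ → ℕ
double zero = zero
double (suc k) = suc (suc (double k))

pairedMod : ℕ → List ℕ → Bool
pairedMod q [] = true
pairedMod q (a ∷ []) = false
pairedMod q (a ∷ c ∷ x) = does (q ∣? a + c) ∧ pairedMod q x

T-pairedMod : ∀ q a c x → T (pairedMod q (a ∷ c ∷ x)) ⇔ (q ∣ a + c × T (pairedMod q x))
T-pairedMod q a c x = mk⇔
  (λ h → let (a+c , x) = Equivalence.to T-∧ h in Equivalence.to (T-does (q ∣? a + c)) a+c , x)
  (λ (q∣a+c , x) → Equivalence.from T-∧ (Equivalence.from (T-does (q ∣? a + c)) q∣a+c , x))

countAssignments-pairedMod : ∀ q k (g h : List ℕ → Bool)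
  → (∀ x → All (_< q) x → length x ≡ double k → h x ≡ g (evens x) ∧ pairedMod q x)
  → countAssignments q (double k) h ≡ countAssignments q k g
countAssignments-pairedMod q zero g h h≡ =
  countAssignments-cong q zero {h} {g} λ { [] _ _ → trans (h≡ [] [] refl) (∧-identityʳ (g [])) }
countAssignments-pairedMod q (suc k) g h h≡ = begin
  countAssignments q (suc (suc (double k))) h
    ≡⟨ countAssignments-suc q (suc (double k)) h ⟩
  sum (applyUpTo (λ v → countAssignments q (suc (double k)) (h ∘ (v ∷_))) q)
    ≡⟨ sum-applyUpTo-cong q fixFirst ⟩
  sum (applyUpTo (λ v → countAssignments q k (g ∘ (v ∷_))) q)
    ≡⟨ countAssignments-suc q k g ⟨
  countAssignments q (suc k) g ∎
  where
  open ≡-Reasoning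

  fixFirst : ∀ v → v < q
    → countAssignments q (suc (double k)) (h ∘ (v ∷_)) ≡ countAssignments q k (g ∘ (v ∷_))
  fixFirst v v<q = begin
    countAssignments q (suc (double k)) (h ∘ (v ∷_))
      ≡⟨ countAssignments-suc q (double k) (h ∘ (v ∷_)) ⟩
    sum (applyUpTo (λ w → countAssignments q (double k) (h ∘ λ x → v ∷ w ∷ x)) q)
      ≡⟨ sum-applyUpTo-single q (negMod q v) (negMod< v<q) unpaired ⟩
    countAssignments q (double k) (h ∘ λ x → v ∷ negMod q v ∷ x)
      ≡⟨ countAssignments-pairedMod q k (g ∘ (v ∷_)) _ paired ⟩
    countAssignments q k (g ∘ (v ∷_)) ∎
    where
    h≡′ : ∀ {w x} → w < q → All (_< q) x → length x ≡ double k
        → h (v ∷ w ∷ x) ≡ g (v ∷ evens x) ∧ (does (q ∣? v + w) ∧ pairedMod q x)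
    h≡′ w<q x<q ∣x∣ = h≡ _ (v<q ∷ w<q ∷ x<q) (cong (suc ∘ suc) ∣x∣)

    paired : ∀ x → All (_< q) x → length x ≡ double k
      → h (v ∷ negMod q v ∷ x) ≡ g (v ∷ evens x) ∧ pairedMod q x
    paired x x<q ∣x∣ = trans (h≡′ (negMod< v<q) x<q ∣x∣)
      (cong (λ b → g (v ∷ evens x) ∧ (b ∧ pairedMod q x)) (dec-true (q ∣? _) (∣+negMod v<q)))

    unpaired : ∀ w → w < q → w ≢ negMod q v
      → countAssignments q (double k) (h ∘ λ x → v ∷ w ∷ x) ≡ 0
    unpaired w w<q w≢ = trans
      (countAssignments-cong q (double k) λ x x<q ∣x∣ → trans (h≡′ w<q x<q ∣x∣)
        (trans (cong (λ b → g (v ∷ evens x) ∧ (b ∧ pairedMod q x))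
                     (dec-false (q ∣? _) (w≢ ∘ ∣+⇒≡negMod v<q w<q)))
               (∧-zeroʳ (g (v ∷ evens x)))))
      (count-false (allAssignments q (double k)))

nonzero : ℕ → Bool
nonzero v = not (v ≡ᵇ 0)

allB-nonzero-pairedMod : ∀ q x → All (_< q) x → T (pairedMod q x)
  → allB nonzero x ≡ allB nonzero (evens x)
allB-nonzero-pairedMod q [] _ _ = refl
allB-nonzero-pairedMod q (a ∷ c ∷ x) (a<q ∷ c<q ∷ x<q) h = begin
  nonzero a ∧ (nonzero c ∧ allB nonzero x)
    ≡⟨ cong (λ z → nonzero a ∧ (not z ∧ allB nonzero x)) c≡ᵇ0 ⟩
  nonzero a ∧ (nonzero a ∧ allB nonzero x)
    ≡⟨ ∧-assoc (nonzero a) (nonzero a) _ ⟨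
  (nonzero a ∧ nonzero a) ∧ allB nonzero x
    ≡⟨ cong₂ _∧_ (∧-idem (nonzero a)) (allB-nonzero-pairedMod q x x<q paired) ⟩
  nonzero a ∧ allB nonzero (evens x) ∎
  where
  open ≡-Reasoning
  open Σ (Equivalence.to (T-pairedMod q a c x) h) renaming (proj₁ to q∣a+c; proj₂ to paired)
  c≡ᵇ0 : (c ≡ᵇ 0) ≡ (a ≡ᵇ 0)
  c≡ᵇ0 = trans (cong (_≡ᵇ 0) (∣+⇒≡negMod a<q c<q q∣a+c)) (negMod≡ᵇ0 a<q)

extensions : ∀ {n} → Subset n → List (Subset (suc n))
extensions s = (outside ∷ s) ∷ (inside ∷ s) ∷ []

∈-concatMap-extensions : ∀ {n} b {s : Subset n} {L} → s ∈ L → (b ∷ s) ∈ concatMap extensions L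
∈-concatMap-extensions false (here refl) = here refl
∈-concatMap-extensions true (here refl) = there (here refl)
∈-concatMap-extensions b (there s∈L) = there (there (∈-concatMap-extensions b s∈L))

∈-allSubsets : ∀ {n} (σ : Subset n) → σ ∈ allSubsets n
∈-allSubsets [] = here refl
∈-allSubsets (b ∷ σ) = ∈-concatMap-extensions b (∈-allSubsets σ)

All≢-concatMap-extensions : ∀ {n} b {s : Subset n} {L}
  → All (s ≢_) L → All ((b ∷ s) ≢_) (concatMap extensions L)
All≢-concatMap-extensions b [] = []
All≢-concatMap-extensions b (s≢ ∷ s≢L) =
  s≢ ∘ cong tail ∷ s≢ ∘ cong tail ∷ All≢-concatMap-extensions b s≢L

unique-concatMap-extensions : ∀ {n} {L : List (Subset n)} → Unique L → Unique (concatMap extensions L)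
unique-concatMap-extensions [] = []
unique-concatMap-extensions (s≢L ∷ u) =
  ((λ ()) ∷ All≢-concatMap-extensions false s≢L) ∷ All≢-concatMap-extensions true s≢L
  ∷ unique-concatMap-extensions u

allSubsets-unique : ∀ n → Unique (allSubsets n)
allSubsets-unique zero = [] ∷ []
allSubsets-unique (suc n) = unique-concatMap-extensions (allSubsets-unique n)

module _ {n} (K : FacePred n) (k : ℕ) where

  ∈-facesOfSize⁺ : ∀ {σ} → T (K σ ∧ (∣ σ ∣ ≡ᵇ k)) → σ ∈ facesOfSize K k
  ∈-facesOfSize⁺ {σ} = ∈-filter⁺ (λ σ → T? (K σ ∧ (∣ σ ∣ ≡ᵇ k))) (∈-allSubsets σ)

  ∈-facesOfSize⁻ : ∀ {σ} → σ ∈ facesOfSize K k → T (K σ ∧ (∣ σ ∣ ≡ᵇ k))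
  ∈-facesOfSize⁻ = proj₂ ∘ ∈-filter⁻ (λ σ → T? (K σ ∧ (∣ σ ∣ ≡ᵇ k))) {xs = allSubsets n}

  facesOfSize-unique : Unique (facesOfSize K k)
  facesOfSize-unique = Unique.filter⁺ (λ σ → T? (K σ ∧ (∣ σ ∣ ≡ᵇ k))) (allSubsets-unique n)

coneFaces : ∀ {n} → Subset n → List (Subset (suc (suc n)))
coneFaces s = (true ∷ false ∷ s) ∷ (false ∷ true ∷ s) ∷ []

length-concatMap-coneFaces : ∀ {n} (S : List (Subset n))
  → length (concatMap coneFaces S) ≡ double (length S)
length-concatMap-coneFaces [] = refl
length-concatMap-coneFaces (s ∷ S) = cong (suc ∘ suc) (length-concatMap-coneFaces S)

filter-extensions² : ∀ {n} (p : Subset (suc (suc n)) → Bool) (s : Subset n) b M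
  → p (false ∷ false ∷ s) ≡ false → p (true ∷ false ∷ s) ≡ b → p (false ∷ true ∷ s) ≡ b
  → p (true ∷ true ∷ s) ≡ false
  → filter (T? ∘ p) (concatMap extensions (extensions s) ++ M)
    ≡ (if b then coneFaces s else []) ++ filter (T? ∘ p) M
filter-extensions² p s true M ff tf ft tt rewrite ff | tf | ft | tt = refl
filter-extensions² p s false M ff tf ft tt rewrite ff | tf | ft | tt = refl

concatMap-filter-∷ : ∀ {A B : Set} (f : A → List B) (p : A → Bool) x xs
  → (if p x then f x else []) ++ concatMap f (filter (T? ∘ p) xs)
    ≡ concatMap f (filter (T? ∘ p) (x ∷ xs))
concatMap-filter-∷ f p x xs with p x
... | true = refl
... | false = refl

facesOfSize-suspension : ∀ {n} (K : FacePred n) k → (∀ σ → T (K σ) → ∣ σ ∣ ≤ k)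
  → facesOfSize (suspension K) (suc k) ≡ concatMap coneFaces (facesOfSize K k)
facesOfSize-suspension {n} K k bound = filter-cones (allSubsets n)
  where
  ofSize ofSizeΣ : _ → Bool
  ofSize σ = K σ ∧ (∣ σ ∣ ≡ᵇ k)
  ofSizeΣ σ = suspension K σ ∧ (∣ σ ∣ ≡ᵇ suc k)

  no-larger-faces : ∀ s → (K s ∧ (∣ s ∣ ≡ᵇ suc k)) ≡ false
  no-larger-faces s with K s in Ks
  ... | false = refl
  ... | true = dec-false (T? (∣ s ∣ ≡ᵇ suc k))
    (<⇒≢ (s≤s (bound s (subst T (sym Ks) _))) ∘ ≡ᵇ⇒≡ ∣ s ∣ (suc k))

  filter-cones : ∀ L → filter (T? ∘ ofSizeΣ) (concatMap extensions (concatMap extensions L))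
                      ≡ concatMap coneFaces (filter (T? ∘ ofSize) L)
  filter-cones [] = refl
  filter-cones (s ∷ L) = begin
    filter (T? ∘ ofSizeΣ) (concatMap extensions (extensions s) ++ concatMap extensions (concatMap extensions L))
      ≡⟨ filter-extensions² ofSizeΣ s (ofSize s) _ (no-larger-faces s) refl refl refl ⟩
    (if ofSize s then coneFaces s else []) ++ filter (T? ∘ ofSizeΣ) (concatMap extensions (concatMap extensions L))
      ≡⟨ cong (_ ++_) (filter-cones L) ⟩
    (if ofSize s then coneFaces s else []) ++ concatMap coneFaces (filter (T? ∘ ofSize) L)
      ≡⟨ concatMap-filter-∷ coneFaces ofSize s L ⟩
    concatMap coneFaces (filter (T? ∘ ofSize) (s ∷ L)) ∎
    where open ≡-Reasoning

-- A chain on concatMap coneFaces S alternates its values on σ ∪ {t} and σ ∪ {b},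
-- so evens and odds are its two halves, each a chain on S.

coneSum : ∀ {n} → List (Subset n) → List ℕ → Subset n → ℕ
coneSum (s ∷ S) (a ∷ c ∷ x) σ =
  if does (≡-dec Bool._≟_ σ s) then a + c + coneSum S x σ else coneSum S x σ
coneSum _ _ _ = 0

boundaryAt-apexT : ∀ {n} (S : List (Subset n)) x τ → length x ≡ double (length S)
  → boundaryAt (concatMap coneFaces S) x (true ∷ false ∷ τ) ≡ - boundaryAt S (evens x) τ
boundaryAt-apexT [] [] τ _ = refl
boundaryAt-apexT (s ∷ S) (a ∷ c ∷ x) τ ∣x∣ rewrite boundaryAt-apexT S x τ (cong (pred ∘ pred) ∣x∣) =
  negate (incidence τ s) (+ a) (+ c) (boundaryAt S (evens x) τ)
  where
  negate : ∀ i a c r → (- i) ℤ.* a ℤ.+ (+0 ℤ.* c ℤ.+ - r) ≡ - (i ℤ.* a ℤ.+ r)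
  negate = solve-∀

boundaryAt-apexB : ∀ {n} (S : List (Subset n)) x τ → length x ≡ double (length S)
  → boundaryAt (concatMap coneFaces S) x (false ∷ true ∷ τ) ≡ - boundaryAt S (odds x) τ
boundaryAt-apexB [] [] τ _ = refl
boundaryAt-apexB (s ∷ S) (a ∷ c ∷ x) τ ∣x∣ rewrite boundaryAt-apexB S x τ (cong (pred ∘ pred) ∣x∣) =
  negate (incidence τ s) (+ a) (+ c) (boundaryAt S (odds x) τ)
  where
  negate : ∀ i a c r → +0 ℤ.* a ℤ.+ ((- i) ℤ.* c ℤ.+ - r) ≡ - (i ℤ.* c ℤ.+ r)
  negate = solve-∀

boundaryAt-base : ∀ {n} (S : List (Subset n)) x σ → length x ≡ double (length S)
  → boundaryAt (concatMap coneFaces S) x (false ∷ false ∷ σ) ≡ + coneSum S x σ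
boundaryAt-base [] [] σ _ = refl
boundaryAt-base (s ∷ S) (a ∷ c ∷ x) σ ∣x∣ rewrite boundaryAt-base S x σ (cong (pred ∘ pred) ∣x∣)
  with does (≡-dec Bool._≟_ σ s)
... | true = trans (cong₂ (λ i j → i ℤ.+ (j ℤ.+ + coneSum S x σ)) (*-identityˡ (+ a)) (*-identityˡ (+ c)))
  (cong +_ (sym (+-assoc a c (coneSum S x σ))))
... | false = refl

pairedMod⇒∣coneSum : ∀ {n} q (S : List (Subset n)) x σ → T (pairedMod q x) → q ∣ coneSum S x σ
pairedMod⇒∣coneSum q [] x σ _ = q ∣0
pairedMod⇒∣coneSum q (s ∷ S) [] σ _ = q ∣0
pairedMod⇒∣coneSum q (s ∷ S) (a ∷ c ∷ x) σ h with does (≡-dec Bool._≟_ σ s)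
... | true = ∣m∣n⇒∣m+n q∣a+c (pairedMod⇒∣coneSum q S x σ paired)
  where open Σ (Equivalence.to (T-pairedMod q a c x) h) renaming (proj₁ to q∣a+c; proj₂ to paired)
... | false = pairedMod⇒∣coneSum q S x σ (proj₂ (Equivalence.to (T-pairedMod q a c x) h))

coneSum-All≢ : ∀ {n} (S : List (Subset n)) x {σ} → All (σ ≢_) S → coneSum S x σ ≡ 0
coneSum-All≢ [] x _ = refl
coneSum-All≢ (s ∷ S) [] _ = refl
coneSum-All≢ (s ∷ S) (a ∷ []) _ = refl
coneSum-All≢ (s ∷ S) (a ∷ c ∷ x) {σ} (σ≢s ∷ σ≢S)
  rewrite dec-false (≡-dec Bool._≟_ σ s) σ≢s = coneSum-All≢ S x σ≢S

∣coneSum⇒pairedMod : ∀ {n} q (S : List (Subset n)) x → Unique S → length x ≡ double (length S)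
  → (∀ {σ} → σ ∈ S → q ∣ coneSum S x σ) → T (pairedMod q x)
∣coneSum⇒pairedMod q [] [] _ _ _ = _
∣coneSum⇒pairedMod q (s ∷ S) (a ∷ c ∷ x) (s≢S ∷ u) ∣x∣ ∣coneSum =
  Equivalence.from (T-pairedMod q a c x)
    (q∣a+c , ∣coneSum⇒pairedMod q S x u (cong (pred ∘ pred) ∣x∣) ∣coneSum-tail)
  where
  q∣a+c : q ∣ a + c
  q∣a+c with ∣coneSum (here refl)
  ... | h rewrite dec-true (≡-dec Bool._≟_ s s) refl | coneSum-All≢ S x s≢S =
    subst (q ∣_) (+-identityʳ (a + c)) h

  ∣coneSum-tail : ∀ {σ} → σ ∈ S → q ∣ coneSum S x σ
  ∣coneSum-tail {σ} σ∈S with ∣coneSum (there σ∈S)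
  ... | h rewrite dec-false (≡-dec Bool._≟_ σ s) (lookup s≢S σ∈S ∘ sym) = h

pairedMod⇒∣boundaryAt-evens+odds : ∀ {n} q (S : List (Subset n)) x τ → T (pairedMod q x)
  → (+ q) ℤ∣.∣ boundaryAt S (evens x) τ ℤ.+ boundaryAt S (odds x) τ
pairedMod⇒∣boundaryAt-evens+odds q [] x τ _ = ℤ∣.∣ᵤ⇒∣ (q ∣0)
pairedMod⇒∣boundaryAt-evens+odds q (s ∷ S) [] τ _ = ℤ∣.∣ᵤ⇒∣ (q ∣0)
pairedMod⇒∣boundaryAt-evens+odds q (s ∷ S) (a ∷ c ∷ x) τ h =
  subst ((+ q) ℤ∣.∣_) (linear (incidence τ s) (+ a) (+ c) _ _)
    (ℤ∣.∣m∣n⇒∣m+n (ℤ∣.∣n⇒∣m*n (incidence τ s) (ℤ∣.∣ᵤ⇒∣ q∣a+c))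
                  (pairedMod⇒∣boundaryAt-evens+odds q S x τ paired))
  where
  open Σ (Equivalence.to (T-pairedMod q a c x) h) renaming (proj₁ to q∣a+c; proj₂ to paired)
  linear : ∀ i a c r r′ → i ℤ.* (a ℤ.+ c) ℤ.+ (r ℤ.+ r′) ≡ (i ℤ.* a ℤ.+ r) ℤ.+ (i ℤ.* c ℤ.+ r′)
  linear = solve-∀

pairedMod⇒∣boundaryAt-odds : ∀ {n} q (S : List (Subset n)) x τ → T (pairedMod q x)
  → q ∣ ℤ.∣ boundaryAt S (evens x) τ ∣ → q ∣ ℤ.∣ boundaryAt S (odds x) τ ∣
pairedMod⇒∣boundaryAt-odds q S x τ h q∣evens = ℤ∣.∣⇒∣ᵤ
  (ℤ∣.∣m+n∣m⇒∣n {m = boundaryAt S (evens x) τ}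
    (pairedMod⇒∣boundaryAt-evens+odds q S x τ h) (ℤ∣.∣ᵤ⇒∣ q∣evens))

cycleMod? : ∀ {n} → ℕ → List (Subset n) → List ℕ → Subset n → Bool
cycleMod? q F x ρ = does (q ∣? ℤ.∣ boundaryAt F x ρ ∣)

IsCycleMod : ∀ {n} → ℕ → List (Subset n) → List ℕ → List (Subset n) → Set
IsCycleMod q F x R = ∀ {ρ} → ρ ∈ R → q ∣ ℤ.∣ boundaryAt F x ρ ∣

T-allB-cycleMod? : ∀ {n} q (F : List (Subset n)) x R → T (allB (cycleMod? q F x) R) ⇔ IsCycleMod q F x R
T-allB-cycleMod? q F x R = mk⇔
  (λ h {ρ} ρ∈R → Equivalence.to (T-does (q ∣? _))
                   (Equivalence.to (T-allB (cycleMod? q F x) R) h {ρ} ρ∈R))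
  (λ h → Equivalence.from (T-allB (cycleMod? q F x) R)
           (λ {ρ} ρ∈R → Equivalence.from (T-does (q ∣? _)) (h {ρ} ρ∈R)))

module _ {n} (Δ : FacePred n) (d : ℕ) (bound : ∀ σ → T (Δ σ) → ∣ σ ∣ ≤ suc d) (q : ℕ) where

  private
    facets = facesOfSize Δ (suc d)
    ridges = facesOfSize Δ d
    ridgesΣ = facesOfSize (suspension Δ) (suc d)

  cycleMod?-suspension : ∀ x → length x ≡ double (length facets)
    → allB (cycleMod? q (concatMap coneFaces facets) x) ridgesΣ
      ≡ allB (cycleMod? q facets (evens x)) ridges ∧ pairedMod q x
  cycleMod?-suspension x ∣x∣ = T-injective (mk⇔
    (λ h → Equivalence.from T-∧
      (Equivalence.from cycleΔ⇔ (evens-cycle (cycleΣ h)) , cycle⇒pairedMod (cycleΣ h)))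
    (λ h → let (c , p) = Equivalence.to T-∧ h in
      Equivalence.from cycleΣ⇔ (cycleΣ-intro (Equivalence.to cycleΔ⇔ c) p)))
    where
    F′ = concatMap coneFaces facets
    cycleΣ⇔ = T-allB-cycleMod? q F′ x ridgesΣ
    cycleΣ = Equivalence.to cycleΣ⇔
    cycleΔ⇔ = T-allB-cycleMod? q facets (evens x) ridges

    ∣∣-apexT : ∀ τ → ℤ.∣ boundaryAt F′ x (true ∷ false ∷ τ) ∣ ≡ ℤ.∣ boundaryAt facets (evens x) τ ∣
    ∣∣-apexT τ = trans (cong ℤ.∣_∣ (boundaryAt-apexT facets x τ ∣x∣))
                       (∣-i∣≡∣i∣ (boundaryAt facets (evens x) τ))

    ∣∣-apexB : ∀ τ → ℤ.∣ boundaryAt F′ x (false ∷ true ∷ τ) ∣ ≡ ℤ.∣ boundaryAt facets (odds x) τ ∣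
    ∣∣-apexB τ = trans (cong ℤ.∣_∣ (boundaryAt-apexB facets x τ ∣x∣))
                       (∣-i∣≡∣i∣ (boundaryAt facets (odds x) τ))

    ∣∣-base : ∀ σ → ℤ.∣ boundaryAt F′ x (false ∷ false ∷ σ) ∣ ≡ coneSum facets x σ
    ∣∣-base σ = cong ℤ.∣_∣ (boundaryAt-base facets x σ ∣x∣)

    evens-cycle : IsCycleMod q F′ x ridgesΣ → IsCycleMod q facets (evens x) ridges
    evens-cycle c {τ} τ∈R = subst (q ∣_) (∣∣-apexT τ)
      (c {true ∷ false ∷ τ} (∈-facesOfSize⁺ (suspension Δ) (suc d) (∈-facesOfSize⁻ Δ d τ∈R)))

    cycle⇒pairedMod : IsCycleMod q F′ x ridgesΣ → T (pairedMod q x)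
    cycle⇒pairedMod c = ∣coneSum⇒pairedMod q facets x (facesOfSize-unique Δ (suc d)) ∣x∣ λ {σ} σ∈F →
      subst (q ∣_) (∣∣-base σ)
        (c {false ∷ false ∷ σ}
          (∈-facesOfSize⁺ (suspension Δ) (suc d) (∈-facesOfSize⁻ Δ (suc d) σ∈F)))

    cycleΣ-intro : IsCycleMod q facets (evens x) ridges → T (pairedMod q x) → IsCycleMod q F′ x ridgesΣ
    cycleΣ-intro c p {false ∷ false ∷ σ} _ =
      subst (q ∣_) (sym (∣∣-base σ)) (pairedMod⇒∣coneSum q facets x σ p)
    cycleΣ-intro c p {true ∷ false ∷ τ} ρ∈R =
      subst (q ∣_) (sym (∣∣-apexT τ))
        (c (∈-facesOfSize⁺ Δ d (∈-facesOfSize⁻ (suspension Δ) (suc d) ρ∈R)))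
    cycleΣ-intro c p {false ∷ true ∷ τ} ρ∈R = subst (q ∣_) (sym (∣∣-apexB τ))
      (pairedMod⇒∣boundaryAt-odds q facets x τ p
        (c (∈-facesOfSize⁺ Δ d (∈-facesOfSize⁻ (suspension Δ) (suc d) ρ∈R))))
    cycleΣ-intro c p {true ∷ true ∷ τ} ρ∈R = ⊥-elim (∈-facesOfSize⁻ (suspension Δ) (suc d) ρ∈R)

  isNZFlow-suspension : ∀ x → All (_< q) x → length x ≡ double (length facets)
    → isNZFlow (suspension Δ) (suc d) q x ≡ isNZFlow Δ d q (evens x) ∧ pairedMod q x
  isNZFlow-suspension x x<q ∣x∣ = begin
    allB nonzero x ∧ allB (cycleMod? q (facesOfSize (suspension Δ) (suc (suc d))) x) ridgesΣ
      ≡⟨ cong (λ F → allB nonzero x ∧ allB (cycleMod? q F x) ridgesΣ)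
              (facesOfSize-suspension Δ (suc d) bound) ⟩
    allB nonzero x ∧ allB (cycleMod? q (concatMap coneFaces facets) x) ridgesΣ
      ≡⟨ cong (allB nonzero x ∧_) (cycleMod?-suspension x ∣x∣) ⟩
    allB nonzero x ∧ (allB (cycleMod? q facets (evens x)) ridges ∧ pairedMod q x)
      ≡⟨ ∧-congˡ-under _ (pairedMod q x) (allB-nonzero-pairedMod q x x<q) ⟩
    (allB nonzero (evens x) ∧ allB (cycleMod? q facets (evens x)) ridges) ∧ pairedMod q x ∎
    where open ≡-Reasoning

lemma4p2 : (n : ℕ) (Δ : FacePred n) (d : ℕ) → IsComplex Δ → 1 ≤ d → HasDim Δ d
           → (q : ℕ) → 1 ≤ q → Φ Δ d q ≡ Φ (suspension Δ) (suc d) q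
lemma4p2 n Δ d _ _ (_ , bound) q _ = sym (begin
  countAssignments q (length (facesOfSize (suspension Δ) (suc (suc d)))) (isNZFlow (suspension Δ) (suc d) q)
    ≡⟨ cong (λ k → countAssignments q k (isNZFlow (suspension Δ) (suc d) q)) #facetsΣ ⟩
  countAssignments q (double (length facets)) (isNZFlow (suspension Δ) (suc d) q)
    ≡⟨ countAssignments-pairedMod q (length facets) (isNZFlow Δ d q) _ (isNZFlow-suspension Δ d bound q) ⟩
  countAssignments q (length facets) (isNZFlow Δ d q) ∎)
  where
  open ≡-Reasoning
  facets = facesOfSize Δ (suc d)
  #facetsΣ : length (facesOfSize (suspension Δ) (suc (suc d))) ≡ double (length facets)
  #facetsΣ = trans (cong length (facesOfSize-suspension Δ (suc d) bound)) (length-concatMap-coneFaces facets)
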